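{- Let $\mathfrak{D}$ be the labeled DAG of the restricted recompression RLSLP of a string $T$ with its path decomposition (see context). Let $u_i$ be an explicit node, let $(u_j,W)$ encode the cached path $\mathbb{P}_{\mathsf{vOcc}}(u_i)$, and let $\mathbb{P}_j$ be the path of the decomposition containing $u_j$. Then \[ \mathsf{vOcc}(u_i) = \begin{cases} \bigcup_{e\in\mathcal{E}_{\mathsf{expl}}(\mathbb{P}_j)} \{ W + \mathcal{L}_E(e) + q \mid q\in\mathsf{vOcc}(\mathrm{src}(e))\} & \text{if } \mathcal{E}_{\mathsf{expl}}(\mathbb{P}_j)\neq\emptyset,\\ \{W+1\} & \text{otherwise.}\end{cases} \]
   Context: Let $\mathcal{G}^R$ be a run-length straight-line program (restricted recompression RLSLP) deriving a string $T$ of length $n$, with rules of the forms $X\rightarrow c$ ($c$ a character), $X\rightarrow YZ$, $X\rightarrow Y$, $X\rightarrow Y^d$ ($d\ge2$); $\mathsf{val}(X)$ is the string derived by $X$. Its DAG $\mathfrak{D}$ has one node per nonterminal; for a rule $X\rightarrow Y_1Y_2\cdots Y_d$ (a run $Y^d$ counted as $d$ copies) there is an edge $e$ from the node of $X$ (source $\mathrm{src}(e)$) to the node of each $Y_k$ (destination), labeled $\mathcal{L}_E(e) = \sum_{t<k}|\mathsf{val}(Y_t)|$. A node is explicit if its out-degree is not $1$, implicit otherwise. Removing every edge whose source is explicit leaves disjoint directed paths, each ending at an explicit node; these form the path decomposition. For a path $\mathbb{P}$ of the decomposition, $\mathcal{E}_{\mathsf{expl}}(\mathbb{P})$ is the set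 of edges whose source is explicit and whose destination lies on $\mathbb{P}$. For a node $u$, $\mathsf{vOcc}(u)$ is the set of starting positions in $T$ (positions $1,\ldots,n$) of the substrings derived by the nodes of the derivation tree labeled with the nonterminal of $u$; equivalently, the set of values $1 + $ (sum of edge labels) over all directed paths from the root to $u$ in $\mathfrak{D}$. Fix a constant $\alpha$ and the word size $B$. For an explicit node $u_i$, $\mathbb{P}_{\mathsf{vOcc}}(u_i)$ is the longest directed path in $\mathfrak{D}$ ending at $u_i$ with at most $\lceil\alpha+\log B\rceil$ edges such that every node on it except its first node $u_j$ has exactly one incoming edge in $\mathfrak{D}$ (if $u_i$ does not have exactly one incoming edge, the path is just $u_i$); it is encoded as $(u_j,W)$ with $W$ the sum of its edge labels ($W=0$ for the trivial path). -}

module Defs where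

open import Data.Nat using (ℕ; zero; suc; _+_; _*_; _≤_)
open import Data.Fin using (Fin; zero; suc; toℕ; inject₁)
open import Data.Vec using (Vec; []; _∷ʳ_; lookup; map)
open import Data.Char using (Char)
open import Data.Product using (Σ; ∃; _×_; _,_; proj₁; proj₂)
open import Data.Sum using (_⊎_)
open import Data.Unit using (⊤)
open import Relation.Binary.PropositionalEquality using (_≡_)
open import Relation.Nullary using (¬_)

data Rule (k : ℕ) : Set where
  term  : Char → Rule k
  pair  : Fin k → Fin k → Rule k
  unary : Fin k → Rule k
  run   : Fin k → (d : ℕ) → 2 ≤ d → Rule k

mapRule : ∀ {k k'} → (Fin k → Fin k') → Rule k → Rule k'
mapRule f (term c)      = term c
mapRule f (pair y z)    = pair (f y) (f z)
mapRule f (unary y)     = unary (f y)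
mapRule f (run y d 2≤d) = run (f y) d 2≤d

ruleLen : ∀ {k} → (Fin k → ℕ) → Rule k → ℕ
ruleLen ℓ (term c)    = 1
ruleLen ℓ (pair y z)  = ℓ y + ℓ z
ruleLen ℓ (unary y)   = ℓ y
ruleLen ℓ (run y d _) = d * ℓ y

-- An RLSLP with m nonterminals 0,…,m-1; the rule of nonterminal i only
-- refers to nonterminals < i (this is exactly acyclicity, up to renaming).
data RLSLP : ℕ → Set where
  []  : RLSLP 0
  _▷_ : ∀ {k} → RLSLP k → Rule k → RLSLP (suc k)

rules : ∀ {m} → RLSLP m → Vec (Rule m) m
rules []      = []
rules (G ▷ r) = map (mapRule inject₁) (rules G) ∷ʳ mapRule inject₁ r

lens : ∀ {m} → RLSLP m → Vec ℕ m
lens []      = []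
lens (G ▷ r) = lens G ∷ʳ ruleLen (lookup (lens G)) r

module _ {m : ℕ} (G : RLSLP m) where

  rule : Fin m → Rule m
  rule = lookup (rules G)

  len : Fin m → ℕ
  len = lookup (lens G)

  -- The DAG 𝔇: out-edges of X are indexed by Fin (outdeg X); a run Y^d
  -- contributes d distinct (parallel) edges.

  outdegR : Rule m → ℕ
  outdegR (term c)    = 0
  outdegR (pair y z)  = 2
  outdegR (unary y)   = 1
  outdegR (run y d _) = d

  childR : (r : Rule m) → Fin (outdegR r) → Fin m
  childR (pair y z) zero       = y
  childR (pair y z) (suc zero) = z
  childR (unary y)  _          = y
  childR (run y d _) _         = y

  -- 𝓛_E: total length of the siblings to the left.
  labelR : (r : Rule m) → Fin (outdegR r) → ℕ
  labelR (pair y z) zero       = 0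
  labelR (pair y z) (suc zero) = len y
  labelR (unary y)  _          = 0
  labelR (run y d _) t         = toℕ t * len y

  outdeg : Fin m → ℕ
  outdeg x = outdegR (rule x)

  Edge : Set
  Edge = Σ (Fin m) (λ x → Fin (outdeg x))

  src : Edge → Fin m
  src = proj₁

  dst : Edge → Fin m
  dst (x , t) = childR (rule x) t

  label : Edge → ℕ
  label (x , t) = labelR (rule x) t

  Explicit : Fin m → Set
  Explicit x = ¬ (outdeg x ≡ 1)

  Implicit : Fin m → Set
  Implicit x = outdeg x ≡ 1

  data Path : Fin m → Fin m → Set where
    []  : ∀ {a} → Path a a
    _∷_ : ∀ {b} (e : Edge) → Path (dst e) b → Path (src e) b

  weight : ∀ {a b} → Path a b → ℕ
  weight []      = 0
  weight (e ∷ π) = label e + weight π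

  plen : ∀ {a b} → Path a b → ℕ
  plen []      = 0
  plen (e ∷ π) = suc (plen π)

  vOcc : Fin m → Fin m → ℕ → Set
  vOcc root u p = Σ (Path root u) (λ π → p ≡ 1 + weight π)

  OneIn : Fin m → Set
  OneIn u = Σ Edge (λ e → dst e ≡ u × (∀ e' → dst e' ≡ u → e' ≡ e))

  TailOneIn : ∀ {a b} → Path a b → Set
  TailOneIn []      = ⊤
  TailOneIn (e ∷ π) = OneIn (dst e) × TailOneIn π

  -- (uj , W) encodes ℙ_vOcc(ui) for the length bound L (= ⌈α + log B⌉).
  CachedPath : ℕ → Fin m → Fin m → ℕ → Set
  CachedPath L ui uj W =
    Σ (Path uj ui) λ π →
      plen π ≤ L × TailOneIn π × W ≡ weight π ×
      (∀ uk (π' : Path uk ui) → plen π' ≤ L → TailOneIn π' → plen π' ≤ plen π)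

  -- Path decomposition: keep exactly the edges with implicit source.

  KeptPath : ∀ {a b} → Path a b → Set
  KeptPath []      = ⊤
  KeptPath (e ∷ π) = Implicit (src e) × KeptPath π

  KeptReach : Fin m → Fin m → Set
  KeptReach a b = Σ (Path a b) KeptPath

  OnPathOf : Fin m → Fin m → Set
  OnPathOf u v = KeptReach u v ⊎ KeptReach v u

  DisjointPaths : Set
  DisjointPaths = ∀ e e' → Implicit (src e) → Implicit (src e') → dst e ≡ dst e' → e ≡ e'

  InEexpl : Fin m → Edge → Set
  InEexpl u e = Explicit (src e) × OnPathOf u (dst e)

  AllReachable : Fin m → Set
  AllReachable root = ∀ u → Path root u

-- A root-to-uᵢ path must end with the cached path π, because every inner node of π has a
-- single in-edge (and the root has none, by acyclicity); hence vOcc(uᵢ) = W + vOcc(uⱼ).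
-- Cutting a root-to-uⱼ path at its last edge e with explicit source leaves only kept edges,
-- whose sources have out-degree 1, i.e. are rules X → Y with label 0; so the path contributes
-- 𝓛(e) + vOcc(src e), and dst e lies on the decomposition path of uⱼ, above uⱼ. No explicit
-- edge enters that path below uⱼ, since those nodes are inner nodes of π whose only in-edge is
-- kept. If no explicit edge enters the path at all, the root itself lies above uⱼ on it, and
-- vOcc(uⱼ) = {1}.
module Submission where

open import Defs
open import Data.Nat using (ℕ; suc; _+_; _<_; _≤_; s≤s; _≟_)
open import Data.Nat.Properties using (≤-refl; <⇒≤; ≤-<-trans; <-irrefl; +-assoc; +-comm; +-identityʳ)
open import Data.Fin using (Fin; zero; suc; toℕ; inject₁)
open import Data.Fin.Properties using (toℕ-inject₁; toℕ<n)
open import Data.Vec using (Vec; []; _∷_; _∷ʳ_; lookup; map)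
open import Data.Vec.Properties using (lookup-map)
open import Data.Product using (Σ; ∃; _×_; _,_; proj₁; proj₂)
open import Data.Sum using (_⊎_; inj₁; inj₂)
open import Data.Empty using (⊥-elim)
open import Data.Unit using (⊤; tt)
open import Function.Bundles using (_⇔_; mk⇔; Equivalence)
open import Relation.Nullary using (¬_; yes; no)
open import Relation.Binary.PropositionalEquality

RefsBelow : ∀ {k} → Rule k → ℕ → Set
RefsBelow (term c)    n = ⊤
RefsBelow (pair y z)  n = toℕ y < n × toℕ z < n
RefsBelow (unary y)   n = toℕ y < n
RefsBelow (run y _ _) n = toℕ y < n

RefsBelow-bound : ∀ {k} (r : Rule k) → RefsBelow r k
RefsBelow-bound (term c)    = tt
RefsBelow-bound (pair y z)  = toℕ<n y , toℕ<n z
RefsBelow-bound (unary y)   = toℕ<n y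
RefsBelow-bound (run y _ _) = toℕ<n y

RefsBelow-inject₁ : ∀ {k n} (r : Rule k) → RefsBelow r n → RefsBelow (mapRule inject₁ r) n
RefsBelow-inject₁ (term c) _ = tt
RefsBelow-inject₁ {n = n} (pair y z)  (y< , z<) =
  subst (_< n) (sym (toℕ-inject₁ y)) y< , subst (_< n) (sym (toℕ-inject₁ z)) z<
RefsBelow-inject₁ {n = n} (unary y)   y< = subst (_< n) (sym (toℕ-inject₁ y)) y<
RefsBelow-inject₁ {n = n} (run y _ _) y< = subst (_< n) (sym (toℕ-inject₁ y)) y<

lookup-∷ʳ⁺ : ∀ {A : Set} (P : A → ℕ → Set) {k} (xs : Vec A k) {y : A} →
             (∀ i → P (lookup xs i) (toℕ i)) → P y k → ∀ i → P (lookup (xs ∷ʳ y) i) (toℕ i)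
lookup-∷ʳ⁺ P []       Pxs Py zero    = Py
lookup-∷ʳ⁺ P (x ∷ xs) Pxs Py zero    = Pxs zero
lookup-∷ʳ⁺ P (x ∷ xs) Pxs Py (suc i) =
  lookup-∷ʳ⁺ (λ a n → P a (suc n)) xs (λ j → Pxs (suc j)) Py i

rule-RefsBelow : ∀ {m} (G : RLSLP m) (x : Fin m) → RefsBelow (rule G x) (toℕ x)
rule-RefsBelow (G ▷ r) =
  lookup-∷ʳ⁺ RefsBelow (map (mapRule inject₁) (rules G)) earlier (RefsBelow-inject₁ r (RefsBelow-bound r))
  where
  earlier : ∀ i → RefsBelow (lookup (map (mapRule inject₁) (rules G)) i) (toℕ i)
  earlier i rewrite lookup-map i (mapRule inject₁) (rules G) =
    RefsBelow-inject₁ (rule G i) (rule-RefsBelow G i)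

Fin-irrelevant : ∀ {n} → n ≡ 1 → (i j : Fin n) → i ≡ j
Fin-irrelevant refl zero zero = refl

module _ {m} (G : RLSLP m) where

  childR-< : ∀ {n} (r : Rule m) → RefsBelow r n → (t : Fin (outdegR G r)) → toℕ (childR G r t) < n
  childR-< (pair y z)  (y< , _) zero       = y<
  childR-< (pair y z)  (_ , z<) (suc zero) = z<
  childR-< (unary y)   y<       _          = y<
  childR-< (run y _ _) y<       _          = y<

  dst<src : (e : Edge G) → toℕ (dst G e) < toℕ (src G e)
  dst<src (x , t) = childR-< (rule G x) (rule-RefsBelow G x) t

  Path-≤ : ∀ {a b} → Path G a b → toℕ b ≤ toℕ a
  Path-≤ []      = ≤-refl
  Path-≤ (e ∷ π) = <⇒≤ (≤-<-trans (Path-≤ π) (dst<src e))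

  no-cycle : (e : Edge G) → ¬ Path G (dst G e) (src G e)
  no-cycle e π = <-irrefl refl (≤-<-trans (Path-≤ π) (dst<src e))

  infixr 5 _++ₚ_
  _++ₚ_ : ∀ {a b c} → Path G a b → Path G b c → Path G a c
  []      ++ₚ τ = τ
  (e ∷ σ) ++ₚ τ = e ∷ (σ ++ₚ τ)

  weight-++ : ∀ {a b c} (σ : Path G a b) (τ : Path G b c) →
              weight G (σ ++ₚ τ) ≡ weight G σ + weight G τ
  weight-++ []      τ = refl
  weight-++ (e ∷ σ) τ = trans (cong (label G e +_) (weight-++ σ τ)) (sym (+-assoc (label G e) _ _))

  unsnoc : ∀ {a b} (σ : Path G a b) →
           (a ≡ b × weight G σ ≡ 0) ⊎ Σ (Edge G) λ e → Σ (Path G a (src G e)) λ τ →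
                     dst G e ≡ b × weight G σ ≡ weight G τ + label G e
  unsnoc []      = inj₁ (refl , refl)
  unsnoc (e ∷ σ) with unsnoc σ
  ... | inj₁ (refl , w≡0)     = inj₂ (e , [] , refl , trans (cong (label G e +_) w≡0) (+-identityʳ _))
  ... | inj₂ (e′ , τ , d , w) =
    inj₂ (e′ , e ∷ τ , d , trans (cong (label G e +_) w) (sym (+-assoc (label G e) _ _)))

  -- A rule with exactly one child is X → Y, since runs have d ≥ 2.
  labelR-outdeg1 : (r : Rule m) → outdegR G r ≡ 1 → (t : Fin (outdegR G r)) → labelR G r t ≡ 0
  labelR-outdeg1 (unary y)            _    _ = refl
  labelR-outdeg1 (run y .1 (s≤s ())) refl _

  label-kept : (e : Edge G) → Implicit G (src G e) → label G e ≡ 0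
  label-kept (x , t) imp = labelR-outdeg1 (rule G x) imp t

  weight-kept : ∀ {a b} (κ : Path G a b) → KeptPath G κ → weight G κ ≡ 0
  weight-kept []      _         = refl
  weight-kept (e ∷ κ) (imp , k) = cong₂ _+_ (label-kept e imp) (weight-kept κ k)

  KeptReach-explicit : ∀ {a b c} → KeptReach G a b → KeptReach G a c → Explicit G c → KeptReach G b c
  KeptReach-explicit (κ₁ , k₁) (κ₂ , k₂) = follow κ₁ k₁ κ₂ k₂
    where
    follow : ∀ {a b c} (κ₁ : Path G a b) → KeptPath G κ₁ → (κ₂ : Path G a c) → KeptPath G κ₂ →
             Explicit G c → KeptReach G b c
    follow []      _         κ₂ k₂ _   = κ₂ , k₂
    follow (_ ∷ _) (imp , _) []  _  exc = ⊥-elim (exc imp)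
    follow ((x , t) ∷ κ₁) (imp , k₁) ((.x , t₂) ∷ κ₂) (_ , k₂) exc with Fin-irrelevant imp t t₂
    ... | refl = follow κ₁ k₁ κ₂ k₂ exc

  first-explicit : ∀ {a w} → Path G a w → Explicit G w →
                   Σ (Fin m) λ x → Explicit G x × KeptReach G a x × Path G x w
  first-explicit {a} [] exw = a , exw , ([] , tt) , []
  first-explicit (e ∷ σ) exw with outdeg G (src G e) ≟ 1
  ... | no ex = src G e , ex , ([] , tt) , e ∷ σ
  ... | yes imp with first-explicit σ exw
  ...   | x , exx , (κ , k) , τ = x , exx , (e ∷ κ , imp , k) , τ

  last-explicit-edge : ∀ {a u v} (σ : Path G a v) → KeptReach G v u →
    (KeptReach G a u × weight G σ ≡ 0)
    ⊎ Σ (Edge G) λ e → InEexpl G u e × Σ (Path G a (src G e)) λ τ → weight G σ ≡ weight G τ + label G e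
  last-explicit-edge [] κ = inj₁ (κ , refl)
  last-explicit-edge (e ∷ σ) κ with last-explicit-edge σ κ
  ... | inj₂ (e′ , inE , τ , w) =
    inj₂ (e′ , inE , e ∷ τ , trans (cong (label G e +_) w) (sym (+-assoc (label G e) _ _)))
  ... | inj₁ ((κ′ , k′) , w) with outdeg G (src G e) ≟ 1
  ...   | yes imp = inj₁ ((e ∷ κ′ , imp , k′) , cong₂ _+_ (label-kept e imp) w)
  ...   | no ex   = inj₂ (e , (ex , inj₂ (κ′ , k′)) , [] , trans (cong (label G e +_) w) (+-identityʳ _))

  ends-with : ∀ {a b c} (π : Path G b c) → TailOneIn G π → (σ : Path G a c) →
              (Σ (Path G a b) λ σ′ → weight G σ ≡ weight G σ′ + weight G π)
              ⊎ Σ (Edge G) (λ e → dst G e ≡ a)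
  ends-with [] _ σ = inj₁ (σ , sym (+-identityʳ _))
  ends-with (e ∷ π) (one , tπ) σ with ends-with π tπ σ
  ... | inj₂ into-a = inj₂ into-a
  ... | inj₁ (σ′ , w) with unsnoc σ′
  ...   | inj₁ (a≡ , _) = inj₂ (e , sym a≡)
  ...   | inj₂ (e′ , τ , d , w′) with one
  ...     | _ , _ , unique with unique e′ d | unique e refl
  ...       | refl | refl =
    inj₁ (τ , trans w (trans (cong (_+ weight G π) w′) (+-assoc (weight G τ) _ _)))

  NoExplicitInEdgeBelow : Fin m → Set
  NoExplicitInEdgeBelow u = ∀ e → Explicit G (src G e) → KeptReach G u (dst G e) → dst G e ≡ u

  cached-path-start : ∀ {a w} (π : Path G a w) → TailOneIn G π → Explicit G w → NoExplicitInEdgeBelow a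
  cached-path-start _ _ _ _ _ ([] , _) = refl
  cached-path-start [] _ exw _ _ (_ ∷ _ , imp , _) = ⊥-elim (exw imp)
  cached-path-start ((x , t′) ∷ π) (one , tπ) exw e exe ((.x , t) ∷ κ , imp , k)
    with Fin-irrelevant imp t t′
  ... | refl with one
  ...   | _ , _ , unique = ⊥-elim (exe (subst (λ e → Implicit G (src G e)) (sym e≡) imp))
    where
    e≡ : e ≡ (x , t)
    e≡ = trans (unique e (cached-path-start π tπ exw e exe (κ , k))) (sym (unique (x , t) refl))

  module _ {root : Fin m} (reach : AllReachable G root) where

    root-no-in-edge : (e : Edge G) → ¬ dst G e ≡ root
    root-no-in-edge e refl = no-cycle e (reach (src G e))

    KeptReach-root⇒no-explicit-in-edges : ∀ {u} → KeptReach G root u → ¬ ∃ (InEexpl G u)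
    KeptReach-root⇒no-explicit-in-edges {u} root→u (e , exe , on)
      with first-explicit (reach (src G e)) exe
    ... | x , exx , root→x , x→src = no-cycle e (dst→x on ++ₚ x→src)
      where
      u→x : KeptReach G u x
      u→x = KeptReach-explicit root→u root→x exx
      dst→x : OnPathOf G u (dst G e) → Path G (dst G e) x
      dst→x (inj₁ u→dst)   = proj₁ (KeptReach-explicit u→dst u→x exx)
      dst→x (inj₂ (κ , _)) = κ ++ₚ proj₁ u→x

    vOcc-along-cached-path : ∀ {a w} (π : Path G a w) → TailOneIn G π → ∀ p →
      vOcc G root w p ⇔ ∃ λ q → vOcc G root a q × p ≡ weight G π + q
    vOcc-along-cached-path {a} {w} π tπ _ = mk⇔ to from
      where
      to : ∀ {p} → vOcc G root w p → ∃ λ q → vOcc G root a q × p ≡ weight G π + q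
      to (σ , refl) with ends-with π tπ σ
      ... | inj₂ (e , d) = ⊥-elim (root-no-in-edge e d)
      ... | inj₁ (σ′ , eq) =
        suc (weight G σ′) , (σ′ , refl) , trans (cong suc eq) (+-comm (suc (weight G σ′)) _)
      from : ∀ {p} → (∃ λ q → vOcc G root a q × p ≡ weight G π + q) → vOcc G root w p
      from (_ , (σ′ , refl) , refl) =
        σ′ ++ₚ π , trans (+-comm (weight G π) _) (cong suc (sym (weight-++ σ′ π)))

    vOcc-via-explicit-in-edges : ∀ {u} → NoExplicitInEdgeBelow u → ∃ (InEexpl G u) → ∀ q →
      vOcc G root u q ⇔
      (Σ (Edge G) λ e → InEexpl G u e × ∃ λ q′ → vOcc G root (src G e) q′ × q ≡ label G e + q′)
    vOcc-via-explicit-in-edges {u} below entries _ = mk⇔ to from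
      where
      to : ∀ {q} → vOcc G root u q →
           Σ (Edge G) λ e → InEexpl G u e × ∃ λ q′ → vOcc G root (src G e) q′ × q ≡ label G e + q′
      to (σ , refl) with last-explicit-edge σ ([] , tt)
      ... | inj₁ (root→u , _) = ⊥-elim (KeptReach-root⇒no-explicit-in-edges root→u entries)
      ... | inj₂ (e , inE , τ , eq) =
        e , inE , suc (weight G τ) , (τ , refl) , trans (cong suc eq) (+-comm (suc (weight G τ)) _)

      dst→u : ∀ {e} → InEexpl G u e → KeptReach G (dst G e) u
      dst→u     (_ , inj₂ dst→u)   = dst→u
      dst→u {e} (exe , inj₁ u→dst) =
        subst (λ v → KeptReach G v u) (sym (below e exe u→dst)) ([] , tt)

      from : ∀ {q} → (Σ (Edge G) λ e → InEexpl G u e × ∃ λ q′ → vOcc G root (src G e) q′ × q ≡ label G e + q′) →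
             vOcc G root u q
      from (e , inE , _ , (τ , refl) , refl) = τ ++ₚ e ∷ κ , eq
        where
        open ≡-Reasoning
        κ : Path G (dst G e) u
        κ = proj₁ (dst→u inE)
        eq : label G e + suc (weight G τ) ≡ suc (weight G (τ ++ₚ e ∷ κ))
        eq = begin
          label G e + suc (weight G τ)           ≡⟨ +-comm (label G e) _ ⟩
          suc (weight G τ + label G e)           ≡⟨ cong (λ l → suc (weight G τ + l)) (sym (+-identityʳ _)) ⟩
          suc (weight G τ + (label G e + 0))     ≡⟨ cong (λ l → suc (weight G τ + (label G e + l)))
                                                         (sym (weight-kept κ (proj₂ (dst→u inE)))) ⟩
          suc (weight G τ + weight G (e ∷ κ))    ≡⟨ cong suc (sym (weight-++ τ (e ∷ κ))) ⟩
          suc (weight G (τ ++ₚ e ∷ κ))           ∎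

    vOcc-without-explicit-in-edges : ∀ {u} → ¬ ∃ (InEexpl G u) → ∀ q → vOcc G root u q ⇔ (q ≡ 1)
    vOcc-without-explicit-in-edges {u} none _ = mk⇔ to from
      where
      weight-0 : ∀ {a} (σ : Path G a u) → weight G σ ≡ 0
      weight-0 σ with last-explicit-edge σ ([] , tt)
      ... | inj₁ (_ , w≡0)     = w≡0
      ... | inj₂ (e , inE , _) = ⊥-elim (none (e , inE))
      to : ∀ {q} → vOcc G root u q → q ≡ 1
      to (σ , refl) = cong suc (weight-0 σ)
      from : ∀ {q} → q ≡ 1 → vOcc G root u q
      from refl = reach u , sym (cong suc (weight-0 (reach u)))

lemma7 : ∀ {m} (G : RLSLP m) (root : Fin m) → AllReachable G root → DisjointPaths G →
    (L : ℕ) (ui : Fin m) → Explicit G ui → (uj : Fin m) (W : ℕ) → CachedPath G L ui uj W →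
    ((∃ λ e → InEexpl G uj e) →
    ∀ p → vOcc G root ui p ⇔
    (Σ (Edge G) λ e → InEexpl G uj e × ∃ λ q → vOcc G root (src G e) q × p ≡ W + label G e + q))
    × ((¬ ∃ λ e → InEexpl G uj e) → ∀ p → vOcc G root ui p ⇔ (p ≡ W + 1))
lemma7 G root reach _ _ ui exui uj W (π , _ , tπ , refl , _) =
  (λ entries _ → mk⇔ (to-entries entries) (from-entries entries)) ,
  (λ none _ → mk⇔ (to-none none) (from-none none))
  where
  shift : ∀ p → vOcc G root ui p ⇔ ∃ λ q → vOcc G root uj q × p ≡ W + q
  shift = vOcc-along-cached-path G reach π tπ

  head : NoExplicitInEdgeBelow G uj
  head = cached-path-start G π tπ exui

  to-entries : ∃ (InEexpl G uj) → ∀ {p} → vOcc G root ui p →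
    Σ (Edge G) λ e → InEexpl G uj e × ∃ λ q → vOcc G root (src G e) q × p ≡ W + label G e + q
  to-entries entries v with Equivalence.to (shift _) v
  ... | q , vq , refl with Equivalence.to (vOcc-via-explicit-in-edges G reach head entries q) vq
  ...   | e , inE , q′ , vq′ , refl = e , inE , q′ , vq′ , sym (+-assoc W (label G e) q′)

  from-entries : ∃ (InEexpl G uj) → ∀ {p} →
    (Σ (Edge G) λ e → InEexpl G uj e × ∃ λ q → vOcc G root (src G e) q × p ≡ W + label G e + q) →
    vOcc G root ui p
  from-entries entries (e , inE , q′ , vq′ , refl) =
    Equivalence.from (shift _)
      (label G e + q′ , Equivalence.from (vOcc-via-explicit-in-edges G reach head entries _) (e , inE , q′ , vq′ , refl) , +-assoc W _ _)

  to-none : ¬ ∃ (InEexpl G uj) → ∀ {p} → vOcc G root ui p → p ≡ W + 1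
  to-none none v with Equivalence.to (shift _) v
  ... | q , vq , refl = cong (W +_) (Equivalence.to (vOcc-without-explicit-in-edges G reach none q) vq)

  from-none : ¬ ∃ (InEexpl G uj) → ∀ {p} → p ≡ W + 1 → vOcc G root ui p
  from-none none refl = Equivalence.from (shift _) (1 , Equivalence.from (vOcc-without-explicit-in-edges G reach none 1) refl , refl)
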